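{- Let $k\ge 0$, $n\ge1$ and $\ell\in\{0,1,\dots,n-1\}$. Then for every $j\in\{1,\dots,n-\ell\}$, $$\mathcal{E}_{(n-\ell,1^\ell)/(j,1^\ell)}(k)=[k]!_q\binom{n-j-\ell}{k}_q\binom{n+j}{k}_q ,$$ where $1^\ell$ denotes $\ell$ parts equal to $1$.
   Context: $q$ is an indeterminate (or scalar). $[a]_q=(1-q^a)/(1-q)$, $[k]!_q=[1]_q\cdots[k]_q$, $\binom nk_q=\frac{[n]!_q}{[k]!_q[n-k]!_q}$ for $n,k\ge0$, interpreted as $0$ if $k>n$. Young diagrams in English notation; cell $(r,s)$ (row $r$, column $s$) has content $s-r$. For partitions $\lambda\vdash n$, $\mu\vdash j$ with $\mu\subseteq\lambda$ such that $\lambda/\mu$ is a horizontal strip (no two cells of $\lambda\setminus\mu$ in one column), fill the cells of $\lambda/\mu$ with $j+1,\dots,n$, rows top to bottom, each row left to right; let $c_\ell$ be the content of the cell containing $\ell$, and $$\mathcal{E}_{\lambda/\mu}(k)=q^{nk-\binom k2}\sum_{j<\ell_1<\cdots<\ell_k\le n}\prod_{m=1}^kq^{ -\ell_m}[\ell_m+1-m+c_{\ell_m}]_q .$$ -}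

module Defs where

open import Level using (Level)
open import Algebra.Bundles using (CommutativeRing)
open import Data.Nat as ℕ using (ℕ; zero; suc; _∸_)
open import Data.Integer as ℤ using (ℤ; +_; -[1+_])
open import Data.List using (List; []; _∷_; map; concat; upTo; replicate; length)
open import Data.Nat.ListAction using (sum)

-- Skew shapes: a partition is a weakly decreasing list of positive parts
-- (rows, top to bottom).

hook : ℕ → ℕ → List ℕ
hook a b = a ∷ replicate b 1

-- The contents of the cells of λ/μ, listed in the order of the filling
-- (rows top to bottom, each row left to right).  Row r (1-based) contributes
-- the cells in columns μ_r+1, …, λ_r, whose content is s - r.
-- (μ is padded by zeros.)
rowContents : ℕ → ℕ → ℕ → List ℤ
rowContents r m l = map (λ i → (+ (m ℕ.+ suc i)) ℤ.- (+ r)) (upTo (l ∸ m))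

skewContentsFrom : ℕ → List ℕ → List ℕ → List ℤ
skewContentsFrom r [] μ = []
skewContentsFrom r (l ∷ λ') [] = rowContents r 0 l ++′ skewContentsFrom (suc r) λ' []
  where open import Data.List using () renaming (_++_ to _++′_)
skewContentsFrom r (l ∷ λ') (m ∷ μ') = rowContents r m l ++′ skewContentsFrom (suc r) λ' μ'
  where open import Data.List using () renaming (_++_ to _++′_)

skewContents : List ℕ → List ℕ → List ℤ
skewContents λ' μ = skewContentsFrom 1 λ' μ

nth : List ℤ → ℕ → ℤ
nth [] i = + 0
nth (x ∷ xs) zero = x
nth (x ∷ xs) (suc i) = nth xs i

-- Strictly increasing sequences lo < x₁ < ⋯ < x_k ≤ hi
incSeqs : ℕ → ℕ → ℕ → List (List ℕ)
incSeqs lo hi zero = [] ∷ []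
incSeqs lo hi (suc k) =
  concat (map (λ i → map (λ xs → (lo ℕ.+ suc i) ∷ xs) (incSeqs (lo ℕ.+ suc i) hi k))
              (upTo (hi ∸ lo)))

binom2 : ℕ → ℕ
binom2 zero = 0
binom2 (suc k) = k ℕ.+ binom2 k

-- q-analogues in a commutative ring R, for an element q with a given
-- two-sided inverse qi (q * qi ≈ 1 is assumed where used).
module QDefs {c ℓ : Level} (R : CommutativeRing c ℓ) (q qi : CommutativeRing.Carrier R) where
  open CommutativeRing R

  pow : Carrier → ℕ → Carrier
  pow x zero = 1#
  pow x (suc n) = x * pow x n

  qpow : ℤ → Carrier
  qpow (+ n) = pow q n
  qpow -[1+ n ] = pow qi (suc n)

  qnat : ℕ → Carrier
  qnat zero = 0#
  qnat (suc n) = 1# + q * qnat n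

  -- [a]_q = (1 - q^a)/(1 - q) for a ∈ ℤ; for a = -m this is -q^{-m}[m]_q
  qint : ℤ → Carrier
  qint (+ n) = qnat n
  qint -[1+ n ] = - (pow qi (suc n) * qnat (suc n))

  qfact : ℕ → Carrier
  qfact zero = 1#
  qfact (suc k) = qnat (suc k) * qfact k

  -- q-binomial coefficient (Gaussian polynomial), via q-Pascal;
  -- equals [n]!/([k]![n-k]!) and is 0 for k > n.
  qbinom : ℕ → ℕ → Carrier
  qbinom zero zero = 1#
  qbinom zero (suc k) = 0#
  qbinom (suc n) zero = 1#
  qbinom (suc n) (suc k) = qbinom n k + pow q (suc k) * qbinom n (suc k)

  sumL : List Carrier → Carrier
  sumL [] = 0#
  sumL (x ∷ xs) = x + sumL xs

  -- ∏_{m} q^{-ℓ_m} [ℓ_m + 1 - m + c_{ℓ_m}]_q, with m starting at index m₀;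
  -- cont ℓ is the content of the cell labelled ℓ.
  term : (ℕ → ℤ) → ℕ → List ℕ → Carrier
  term cont m [] = 1#
  term cont m (l ∷ ls) =
    (pow qi l * qint ((+ l) ℤ.+ (+ 1) ℤ.- (+ m) ℤ.+ cont l)) * term cont (suc m) ls

  -- 𝓔_{λ/μ}(k) with n = |λ|, j = |μ|; the cell labelled ℓ (j < ℓ ≤ n)
  -- is the (ℓ - j)-th cell of λ/μ in the filling order.
  𝓔 : List ℕ → List ℕ → ℕ → Carrier
  𝓔 λ' μ k =
    qpow ((+ (n ℕ.* k)) ℤ.- (+ binom2 k)) *
    sumL (map (term cont 1) (incSeqs j n k))
    where
      n = sum λ'
      j = sum μ
      cont : ℕ → ℤ
      cont l = nth (skewContents λ' μ) (l ∸ suc j)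

{-# OPTIONS --safe #-}

-- The skew shape (n-ℓ, 1^ℓ)/(j, 1^ℓ) is the segment of the first row in columns j+1, …, n-ℓ, so the
-- label x has content x-ℓ-1, and q^{C(k,2)} 𝓔 = q^{nk} Σ is a sum over increasing sequences in a
-- segment of length D = n-j-ℓ. Splitting on whether the first cell is used shows that this sum,
-- as a function X(D, e, k) with e = 2j+ℓ, satisfies
--   X(D+1, e, k+1) = q^D [e+1] X(D, e+1, k) + X(D, e+2, k+1),   X(D, e, 0) = 1,   X(0, e, k+1) = 0.
-- By q-Pascal and the absorption identity [k+1] B(m, k+1) = [m-k] B(m, k), the closed form
-- q^{C(k,2)} [k]! B(D, k) B(D+e, k) satisfies the same recursion; note D + e = n + j.
module Submission where

open import Defs
open import Level using (Level)
open import Algebra.Bundles using (CommutativeRing)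
import Algebra.Solver.Ring.NaturalCoefficients.Default as NaturalCoefficients
open import Data.Nat as ℕ using (ℕ; zero; suc; _∸_; _≤_; _<_; s≤s; z≤n)
import Data.Nat.Properties as ℕP
open import Data.Nat.Tactic.RingSolver using (solve-∀)
open import Data.Nat.ListAction using (sum)
open import Data.Integer as ℤ using (ℤ; +_; _⊖_)
import Data.Integer.Properties as ℤP
import Data.Integer.Tactic.RingSolver as ℤSolver
open import Data.List using (List; []; _∷_; _++_; map; concat; upTo; applyUpTo; replicate)
import Data.List.Properties as ListP
open import Data.Product using (_,_)
open import Function using (_∘_)
open import Relation.Nullary using (yes; no)
open import Relation.Binary.PropositionalEquality as ≡ using (_≡_)

sum-replicate-1 : ∀ n → sum (replicate n 1) ≡ n
sum-replicate-1 zero    = ≡.refl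
sum-replicate-1 (suc n) = ≡.cong suc (sum-replicate-1 n)

∸-∸-comm : ∀ m n o → m ∸ n ∸ o ≡ m ∸ o ∸ n
∸-∸-comm m n o = begin
  m ∸ n ∸ o      ≡⟨ ℕP.∸-+-assoc m n o ⟩
  m ∸ (n ℕ.+ o)  ≡⟨ ≡.cong (m ∸_) (ℕP.+-comm n o) ⟩
  m ∸ (o ℕ.+ n)  ≡⟨ ℕP.∸-+-assoc m o n ⟨
  m ∸ o ∸ n      ∎
  where open ≡.≡-Reasoning

+[m+n]-+m≡+n : ∀ m n → + (m ℕ.+ n) ℤ.- + m ≡ + n
+[m+n]-+m≡+n m n = begin
  + (m ℕ.+ n) ℤ.- + m  ≡⟨ ℤP.[+m]-[+n]≡m⊖n (m ℕ.+ n) m ⟩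
  (m ℕ.+ n) ⊖ m        ≡⟨ ℤP.⊖-≥ (ℕP.m≤m+n m n) ⟩
  + (m ℕ.+ n ∸ m)      ≡⟨ ≡.cong +_ (ℕP.m+n∸m≡n m n) ⟩
  + n                  ∎
  where open ≡.≡-Reasoning

+a-+m++c≡+b : ∀ a m c {b} → a ℕ.+ c ≡ m ℕ.+ b → + a ℤ.- + m ℤ.+ + c ≡ + b
+a-+m++c≡+b a m c {b} a+c≡m+b = begin
  + a ℤ.- + m ℤ.+ + c  ≡⟨ ℤ-rearrange (+ a) (+ m) (+ c) ⟩
  + (a ℕ.+ c) ℤ.- + m  ≡⟨ ≡.cong (λ t → + t ℤ.- + m) a+c≡m+b ⟩
  + (m ℕ.+ b) ℤ.- + m  ≡⟨ +[m+n]-+m≡+n m b ⟩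
  + b                  ∎
  where
  open ≡.≡-Reasoning
  ℤ-rearrange : ∀ x y z → x ℤ.- y ℤ.+ z ≡ x ℤ.+ z ℤ.- y
  ℤ-rearrange = ℤSolver.solve-∀

concat-map-upTo-suc : ∀ {a} {A : Set a} (f : ℕ → List A) n →
  concat (map f (upTo (suc n))) ≡ f 0 ++ concat (map (f ∘ suc) (upTo n))
concat-map-upTo-suc f n = ≡.cong (λ xss → f 0 ++ concat xss)
  (≡.trans (ListP.map-applyUpTo suc f n) (≡.sym (ListP.map-upTo (f ∘ suc) n)))

incSeqsWithHead : ℕ → ℕ → ℕ → List (List ℕ)
incSeqsWithHead hi k x = map (x ∷_) (incSeqs x hi k)

incSeqs-empty : ∀ lo hi k → hi ≤ lo → incSeqs lo hi (suc k) ≡ []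
incSeqs-empty lo hi k hi≤lo =
  ≡.cong (λ n → concat (map (incSeqsWithHead hi k ∘ (lo ℕ.+_) ∘ suc) (upTo n))) (ℕP.m≤n⇒m∸n≡0 hi≤lo)

incSeqs-split : ∀ lo hi k → lo < hi →
  incSeqs lo hi (suc k) ≡ map (suc lo ∷_) (incSeqs (suc lo) hi k) ++ incSeqs (suc lo) hi (suc k)
incSeqs-split lo hi k lo<hi = begin
  concat (map (start ∘ (lo ℕ.+_) ∘ suc) (upTo (hi ∸ lo)))
    ≡⟨ ≡.cong (λ n → concat (map (start ∘ (lo ℕ.+_) ∘ suc) (upTo n))) (ℕP.+-∸-assoc 1 lo<hi) ⟩
  concat (map (start ∘ (lo ℕ.+_) ∘ suc) (upTo (suc (hi ∸ suc lo))))
    ≡⟨ concat-map-upTo-suc (start ∘ (lo ℕ.+_) ∘ suc) (hi ∸ suc lo) ⟩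
  start (lo ℕ.+ 1) ++ concat (map (start ∘ (lo ℕ.+_) ∘ suc ∘ suc) (upTo (hi ∸ suc lo)))
    ≡⟨ ≡.cong₂ (λ x xss → start x ++ concat xss) (ℕP.+-comm lo 1)
         (ListP.map-cong (λ i → ≡.cong start (ℕP.+-suc lo (suc i))) (upTo (hi ∸ suc lo))) ⟩
  start (suc lo) ++ concat (map (start ∘ suc ∘ (lo ℕ.+_) ∘ suc) (upTo (hi ∸ suc lo))) ∎
  where
  open ≡.≡-Reasoning
  start = incSeqsWithHead hi k

nth-applyUpTo : ∀ (f : ℕ → ℤ) n i → i < n → nth (applyUpTo f n) i ≡ f i
nth-applyUpTo f (suc n) zero    _         = ≡.refl
nth-applyUpTo f (suc n) (suc i) (s≤s i<n) = nth-applyUpTo (f ∘ suc) n i i<n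

nth-rowContents : ∀ r m l i → i < l ∸ m → nth (rowContents r m l) i ≡ + (m ℕ.+ suc i) ℤ.- + r
nth-rowContents r m l i i<l∸m =
  ≡.trans (≡.cong (λ xs → nth xs i) (ListP.map-upTo _ (l ∸ m))) (nth-applyUpTo _ (l ∸ m) i i<l∸m)

rowContents-self : ∀ r l → rowContents r l l ≡ []
rowContents-self r l = ≡.cong (λ n → map (λ i → + (l ℕ.+ suc i) ℤ.- + r) (upTo n)) (ℕP.n∸n≡0 l)

skewContentsFrom-self : ∀ r ls → skewContentsFrom r ls ls ≡ []
skewContentsFrom-self r []       = ≡.refl
skewContentsFrom-self r (l ∷ ls) =
  ≡.cong₂ _++_ (rowContents-self r l) (skewContentsFrom-self (suc r) ls)

RowSegment : (ℕ → ℤ) → ℕ → ℕ → ℕ → Set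
RowSegment cont lo d c = ∀ i → i < d → cont (suc (i ℕ.+ lo)) ≡ + (i ℕ.+ c)

RowSegment-tail : ∀ {cont lo d c} → RowSegment cont lo (suc d) c → RowSegment cont (suc lo) d (suc c)
RowSegment-tail {lo = lo} {c = c} seg i i<d rewrite ℕP.+-suc i lo | ℕP.+-suc i c = seg (suc i) (s≤s i<d)

-- Definitionally the content function inside 𝓔.
labelContent : List ℕ → List ℕ → ℕ → ℤ
labelContent outer inner x = nth (skewContents outer inner) (x ∸ suc (sum inner))

hook-RowSegment : ∀ j D ℓ → RowSegment (labelContent (hook (j ℕ.+ D) ℓ) (hook j ℓ)) (sum (hook j ℓ)) D j
hook-RowSegment j D ℓ i i<D = begin
  nth (rowContents 1 j (j ℕ.+ D) ++ skewContentsFrom 2 ones ones) (i ℕ.+ lo ∸ lo)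
    ≡⟨ ≡.cong₂ nth (≡.cong (rowContents 1 j (j ℕ.+ D) ++_) (skewContentsFrom-self 2 ones))
                   (ℕP.m+n∸n≡m i lo) ⟩
  nth (rowContents 1 j (j ℕ.+ D) ++ []) i
    ≡⟨ ≡.cong (λ xs → nth xs i) (ListP.++-identityʳ (rowContents 1 j (j ℕ.+ D))) ⟩
  nth (rowContents 1 j (j ℕ.+ D)) i
    ≡⟨ nth-rowContents 1 j (j ℕ.+ D) i (≡.subst (i <_) (≡.sym (ℕP.m+n∸m≡n j D)) i<D) ⟩
  + (j ℕ.+ suc i) ℤ.- + 1
    ≡⟨ ≡.cong (λ n → + n ℤ.- + 1) (≡.trans (ℕP.+-suc j i) (≡.cong suc (ℕP.+-comm j i))) ⟩
  + (1 ℕ.+ (i ℕ.+ j)) ℤ.- + 1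
    ≡⟨ +[m+n]-+m≡+n 1 (i ℕ.+ j) ⟩
  + (i ℕ.+ j) ∎
  where
  open ≡.≡-Reasoning
  ones = replicate ℓ 1
  lo = sum (hook j ℓ)

module QCalculus {c l : Level} (R : CommutativeRing c l) (q qi : CommutativeRing.Carrier R) where
  open CommutativeRing R
  open QDefs R q qi
  open NaturalCoefficients commutativeSemiring
  open import Relation.Binary.Reasoning.Setoid setoid

  pow-+ : ∀ x a b → pow x (a ℕ.+ b) ≈ pow x a * pow x b
  pow-+ x zero    b = sym (*-identityˡ _)
  pow-+ x (suc a) b = trans (*-congˡ (pow-+ x a b)) (sym (*-assoc _ _ _))

  qnat-+ : ∀ a b → qnat (a ℕ.+ b) ≈ qnat a + pow q a * qnat b
  qnat-+ zero    b = solve 1 (λ x → x := con 0 :+ con 1 :* x) refl (qnat b)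
  qnat-+ (suc a) b = begin
    1# + q * qnat (a ℕ.+ b)               ≈⟨ +-congˡ (*-congˡ (qnat-+ a b)) ⟩
    1# + q * (qnat a + pow q a * qnat b)
      ≈⟨ solve 4 (λ x y z w → con 1 :+ x :* (y :+ z :* w) := (con 1 :+ x :* y) :+ (x :* z) :* w)
               refl q (qnat a) (pow q a) (qnat b) ⟩
    (1# + q * qnat a) + (q * pow q a) * qnat b ∎

  qnat-suc : ∀ k → qnat (suc k) ≈ qnat k + pow q k
  qnat-suc zero    = solve 1 (λ x → con 1 :+ x :* con 0 := con 0 :+ con 1) refl q
  qnat-suc (suc k) = begin
    1# + q * qnat (suc k)         ≈⟨ +-congˡ (*-congˡ (qnat-suc k)) ⟩
    1# + q * (qnat k + pow q k)
      ≈⟨ solve 3 (λ x a p → con 1 :+ x :* (a :+ p) := (con 1 :+ x :* a) :+ x :* p) refl q (qnat k) (pow q k) ⟩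
    (1# + q * qnat k) + q * pow q k ∎

  qbinom[n,0]≈1 : ∀ n → qbinom n 0 ≈ 1#
  qbinom[n,0]≈1 zero    = refl
  qbinom[n,0]≈1 (suc n) = refl

  qbinom[n,1]≈[n] : ∀ n → qbinom n 1 ≈ qnat n
  qbinom[n,1]≈[n] zero    = refl
  qbinom[n,1]≈[n] (suc n) = begin
    qbinom n 0 + (q * 1#) * qbinom n 1  ≈⟨ +-cong (qbinom[n,0]≈1 n) (*-congˡ (qbinom[n,1]≈[n] n)) ⟩
    1# + (q * 1#) * qnat n              ≈⟨ +-congˡ (*-congʳ (*-identityʳ q)) ⟩
    1# + q * qnat n                     ∎

  n<k⇒qbinom[n,k]≈0 : ∀ {n k} → n < k → qbinom n k ≈ 0#
  n<k⇒qbinom[n,k]≈0 {zero}  {suc k} _         = refl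
  n<k⇒qbinom[n,k]≈0 {suc n} {suc k} (s≤s n<k) = begin
    qbinom n k + pow q (suc k) * qbinom n (suc k)
      ≈⟨ +-cong (n<k⇒qbinom[n,k]≈0 n<k) (*-congˡ (n<k⇒qbinom[n,k]≈0 (ℕP.m<n⇒m<1+n n<k))) ⟩
    0# + pow q (suc k) * 0#  ≈⟨ trans (+-identityˡ _) (zeroʳ _) ⟩
    0#                       ∎

  qbinom-absorption : ∀ k r {n} → k ℕ.+ r ≡ n → qnat (suc k) * qbinom n (suc k) ≈ qnat r * qbinom n k
  qbinom-absorption zero r ≡.refl = begin
    qnat 1 * qbinom r 1  ≈⟨ *-congˡ (qbinom[n,1]≈[n] r) ⟩
    qnat 1 * qnat r      ≈⟨ solve 2 (λ x b → (con 1 :+ x :* con 0) :* b := b :* con 1) refl q (qnat r) ⟩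
    qnat r * 1#          ≈⟨ *-congˡ (qbinom[n,0]≈1 r) ⟨
    qnat r * qbinom r 0  ∎
  qbinom-absorption (suc k) zero ≡.refl = begin
    qnat (suc (suc k)) * qbinom (suc k ℕ.+ 0) (suc (suc k))
      ≈⟨ *-congˡ (n<k⇒qbinom[n,k]≈0 (s≤s (s≤s (ℕP.≤-reflexive (ℕP.+-identityʳ k))))) ⟩
    qnat (suc (suc k)) * 0#             ≈⟨ trans (zeroʳ _) (sym (zeroˡ _)) ⟩
    0# * qbinom (suc k ℕ.+ 0) (suc k)   ∎
  qbinom-absorption (suc k) (suc r) ≡.refl = begin
    K₂ * (Y + (q * (q * pk)) * W)
      ≈⟨ solve 5 (λ k₂ y x p w → k₂ :* (y :+ (x :* (x :* p)) :* w) := k₂ :* y :+ (x :* (x :* p)) :* (k₂ :* w))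
               refl K₂ Y q pk W ⟩
    K₂ * Y + (q * (q * pk)) * (K₂ * W)
      ≈⟨ +-cong (*-congʳ (qnat-suc (suc k)))
                (*-congˡ (qbinom-absorption (suc k) r (≡.sym (ℕP.+-suc k r)))) ⟩
    (K₁ + q * pk) * Y + (q * (q * pk)) * (qnat r * Y)
      ≈⟨ solve 5 (λ k₁ x p y b → (k₁ :+ x :* p) :* y :+ (x :* (x :* p)) :* (b :* y)
                              := k₁ :* y :+ (x :* p) :* ((con 1 :+ x :* b) :* y))
               refl K₁ q pk Y (qnat r) ⟩
    K₁ * Y + (q * pk) * (qnat (suc r) * Y)
      ≈⟨ +-congʳ (qbinom-absorption k (suc r) ≡.refl) ⟩
    qnat (suc r) * Z + (q * pk) * (qnat (suc r) * Y)
      ≈⟨ solve 5 (λ r z x p y → r :* z :+ (x :* p) :* (r :* y) := r :* (z :+ (x :* p) :* y))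
               refl (qnat (suc r)) Z q pk Y ⟩
    qnat (suc r) * (Z + (q * pk) * Y) ∎
    where
    n = k ℕ.+ suc r
    K₁ = qnat (suc k)
    K₂ = qnat (suc (suc k))
    pk = pow q k
    Y = qbinom n (suc k)
    Z = qbinom n k
    W = qbinom n (suc (suc k))

  productFormula : ℕ → ℕ → ℕ → Carrier
  productFormula d e k = qfact k * qbinom d k * qbinom (d ℕ.+ e) k

  productFormula-vanishes : ∀ {d k} e → d < k → productFormula d e k ≈ 0#
  productFormula-vanishes e d<k =
    trans (*-congʳ (trans (*-congˡ (n<k⇒qbinom[n,k]≈0 d<k)) (zeroʳ _))) (zeroˡ _)

  productFormula-rec-< : ∀ {d k} e → d < k →
    pow q k * productFormula (suc d) e (suc k) ≈
    pow q d * qnat (suc e) * productFormula d (suc e) k + pow q k * productFormula d (suc (suc e)) (suc k)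
  productFormula-rec-< {d} {k} e d<k = begin
    pow q k * productFormula (suc d) e (suc k)  ≈⟨ *-congˡ (productFormula-vanishes e (s≤s d<k)) ⟩
    pow q k * 0#
      ≈⟨ solve 2 (λ x y → x :* con 0 := y :* con 0 :+ x :* con 0) refl (pow q k) (pow q d * qnat (suc e)) ⟩
    pow q d * qnat (suc e) * 0# + pow q k * 0#
      ≈⟨ +-cong (*-congˡ (productFormula-vanishes (suc e) d<k))
                (*-congˡ (productFormula-vanishes (suc (suc e)) (ℕP.m<n⇒m<1+n d<k))) ⟨
    pow q d * qnat (suc e) * productFormula d (suc e) k + pow q k * productFormula d (suc (suc e)) (suc k) ∎

  -- After q-Pascal on both sides, absorption turns the identity into [r+e+1] = [r] + q^r [e+1].
  productFormula-rec-+ : ∀ k r e →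
    pow q k * productFormula (suc (k ℕ.+ r)) e (suc k) ≈
    pow q (k ℕ.+ r) * qnat (suc e) * productFormula (k ℕ.+ r) (suc e) k +
    pow q k * productFormula (k ℕ.+ r) (suc (suc e)) (suc k)
  productFormula-rec-+ k r e = begin
    pk * (K * f * (X + q * pk * Y) * W)
      ≈⟨ solve 7 (λ pk K f X Y W q → pk :* (K :* f :* (X :+ q :* pk :* Y) :* W)
                                  := pk :* f :* X :* (K :* W) :+ q :* pk :* pk :* f :* Y :* (K :* W))
               refl pk K f X Y W q ⟩
    pk * f * X * (K * W) + T
      ≈⟨ +-congʳ (*-congˡ K*W≈[r+e+1]*Z) ⟩
    pk * f * X * ((qnat r + pr * E) * Z) + T
      ≈⟨ solve 8 (λ pk f X b pr E Z T → pk :* f :* X :* ((b :+ pr :* E) :* Z) :+ T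
                                     := pk :* pr :* E :* (f :* X :* Z) :+ pk :* f :* (b :* X) :* Z :+ T)
               refl pk f X (qnat r) pr E Z T ⟩
    pk * pr * E * (f * X * Z) + pk * f * (qnat r * X) * Z + T
      ≈⟨ +-congʳ (+-congˡ (*-congʳ (*-congˡ (qbinom-absorption k r ≡.refl)))) ⟨
    pk * pr * E * (f * X * Z) + pk * f * (K * Y) * Z + T
      ≈⟨ solve 8 (λ A pk f K Y Z q W → A :+ pk :* f :* (K :* Y) :* Z :+ q :* pk :* pk :* f :* Y :* (K :* W)
                                    := A :+ pk :* (K :* f :* Y :* (Z :+ q :* pk :* W)))
               refl (pk * pr * E * (f * X * Z)) pk f K Y Z q W ⟩
    pk * pr * E * (f * X * Z) + pk * (K * f * Y * (Z + q * pk * W))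
      ≈⟨ +-congʳ (*-congʳ (*-congʳ (pow-+ q k r))) ⟨
    pow q (k ℕ.+ r) * E * (f * X * Z) + pk * (K * f * Y * (Z + q * pk * W))
      ≡⟨ ≡.cong₂ (λ n n′ → pow q (k ℕ.+ r) * E * (f * X * qbinom n k)
                              + pk * (K * f * Y * qbinom n′ (suc k)))
                 (≡.sym (ℕP.+-suc (k ℕ.+ r) e))
                 (≡.sym (≡.trans (ℕP.+-suc (k ℕ.+ r) (suc e)) (≡.cong suc (ℕP.+-suc (k ℕ.+ r) e)))) ⟩
    pow q (k ℕ.+ r) * E * productFormula (k ℕ.+ r) (suc e) k
      + pk * productFormula (k ℕ.+ r) (suc (suc e)) (suc k) ∎
    where
    pk = pow q k
    pr = pow q r
    K = qnat (suc k)
    f = qfact k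
    E = qnat (suc e)
    X = qbinom (k ℕ.+ r) k
    Y = qbinom (k ℕ.+ r) (suc k)
    Z = qbinom (suc (k ℕ.+ r ℕ.+ e)) k
    W = qbinom (suc (k ℕ.+ r ℕ.+ e)) (suc k)
    T = q * pk * pk * f * Y * (K * W)
    K*W≈[r+e+1]*Z : K * W ≈ (qnat r + pr * E) * Z
    K*W≈[r+e+1]*Z = trans (qbinom-absorption k (r ℕ.+ suc e) k+[r+e+1]≡)
                          (*-congʳ (qnat-+ r (suc e)))
      where
      k+[r+e+1]≡ : k ℕ.+ (r ℕ.+ suc e) ≡ suc (k ℕ.+ r ℕ.+ e)
      k+[r+e+1]≡ = ≡.trans (≡.sym (ℕP.+-assoc k r (suc e))) (ℕP.+-suc (k ℕ.+ r) e)

  productFormula-rec : ∀ d e k →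
    pow q k * productFormula (suc d) e (suc k) ≈
    pow q d * qnat (suc e) * productFormula d (suc e) k + pow q k * productFormula d (suc (suc e)) (suc k)
  productFormula-rec d e k with k ℕ.≤? d
  ... | no k≰d = productFormula-rec-< e (ℕP.≰⇒> k≰d)
  ... | yes k≤d with ℕP.m≤n⇒∃[o]m+o≡n k≤d
  ...   | r , ≡.refl = productFormula-rec-+ k r e

  scaledProductFormula : ℕ → ℕ → ℕ → Carrier
  scaledProductFormula d e k = pow q (binom2 k) * productFormula d e k

  scaledProductFormula[d,e,0]≈1 : ∀ d e → scaledProductFormula d e 0 ≈ 1#
  scaledProductFormula[d,e,0]≈1 d e = begin
    1# * (1# * qbinom d 0 * qbinom (d ℕ.+ e) 0)
      ≈⟨ *-congˡ (*-cong (*-congˡ (qbinom[n,0]≈1 d)) (qbinom[n,0]≈1 (d ℕ.+ e))) ⟩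
    1# * (1# * 1# * 1#)                          ≈⟨ solve 0 (con 1 :* (con 1 :* con 1 :* con 1) := con 1) refl ⟩
    1#                                           ∎

  scaledProductFormula[0,e,1+k]≈0 : ∀ e k → scaledProductFormula 0 e (suc k) ≈ 0#
  scaledProductFormula[0,e,1+k]≈0 e k =
    trans (*-congˡ (productFormula-vanishes e (s≤s z≤n))) (zeroʳ _)

  scaledProductFormula-rec : ∀ d e k →
    scaledProductFormula (suc d) e (suc k) ≈
    pow q d * qnat (suc e) * scaledProductFormula d (suc e) k + scaledProductFormula d (suc (suc e)) (suc k)
  scaledProductFormula-rec d e k = begin
    pow q (k ℕ.+ C) * P₀                 ≈⟨ *-congʳ (pow-+ q k C) ⟩
    pow q k * pow q C * P₀
      ≈⟨ solve 3 (λ pk pC P → pk :* pC :* P := pC :* (pk :* P)) refl (pow q k) (pow q C) P₀ ⟩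
    pow q C * (pow q k * P₀)             ≈⟨ *-congˡ (productFormula-rec d e k) ⟩
    pow q C * (pow q d * E * P₁ + pow q k * P₂)
      ≈⟨ solve 5 (λ pC pdE P₁ pk P₂ → pC :* (pdE :* P₁ :+ pk :* P₂) := pdE :* (pC :* P₁) :+ pk :* pC :* P₂)
               refl (pow q C) (pow q d * E) P₁ (pow q k) P₂ ⟩
    pow q d * E * (pow q C * P₁) + pow q k * pow q C * P₂
      ≈⟨ +-congˡ (*-congʳ (pow-+ q k C)) ⟨
    pow q d * E * (pow q C * P₁) + pow q (k ℕ.+ C) * P₂ ∎
    where
    C = binom2 k
    E = qnat (suc e)
    P₀ = productFormula (suc d) e (suc k)
    P₁ = productFormula d (suc e) k
    P₂ = productFormula d (suc (suc e)) (suc k)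

  sumL-map-++ : ∀ {a} {A : Set a} (f : A → Carrier) xs ys →
    sumL (map f (xs ++ ys)) ≈ sumL (map f xs) + sumL (map f ys)
  sumL-map-++ f []       ys = sym (+-identityˡ _)
  sumL-map-++ f (x ∷ xs) ys = trans (+-congˡ (sumL-map-++ f xs ys)) (sym (+-assoc _ _ _))

  sumL-map-*ˡ : ∀ {a} {A : Set a} y (f : A → Carrier) xs →
    sumL (map (λ x → y * f x) xs) ≈ y * sumL (map f xs)
  sumL-map-*ˡ y f []       = sym (zeroʳ y)
  sumL-map-*ˡ y f (x ∷ xs) = trans (+-congˡ (sumL-map-*ˡ y f xs)) (sym (distribˡ _ _ _))

  module _ (q*qi≈1 : q * qi ≈ 1#) where

    pow-inverse : ∀ a → pow q a * pow qi a ≈ 1#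
    pow-inverse zero    = *-identityˡ 1#
    pow-inverse (suc a) = begin
      q * pow q a * (qi * pow qi a)
        ≈⟨ solve 4 (λ x y z w → (x :* y) :* (z :* w) := (x :* z) :* (y :* w)) refl q (pow q a) qi (pow qi a) ⟩
      q * qi * (pow q a * pow qi a)    ≈⟨ *-cong q*qi≈1 (pow-inverse a) ⟩
      1# * 1#                          ≈⟨ *-identityˡ 1# ⟩
      1#                               ∎

    pow-+-cancelˡ : ∀ a b → pow q (a ℕ.+ b) * pow qi a ≈ pow q b
    pow-+-cancelˡ a b = begin
      pow q (a ℕ.+ b) * pow qi a        ≈⟨ *-congʳ (pow-+ q a b) ⟩
      pow q a * pow q b * pow qi a
        ≈⟨ solve 3 (λ x y z → x :* y :* z := x :* z :* y) refl (pow q a) (pow q b) (pow qi a) ⟩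
      pow q a * pow qi a * pow q b      ≈⟨ *-congʳ (pow-inverse a) ⟩
      1# * pow q b                      ≈⟨ *-identityˡ _ ⟩
      pow q b                           ∎

    pow-inverse-cancelˡ : ∀ a x → pow qi a * (pow q a * x) ≈ x
    pow-inverse-cancelˡ a x = begin
      pow qi a * (pow q a * x)  ≈⟨ solve 3 (λ y z x → y :* (z :* x) := z :* y :* x) refl (pow qi a) (pow q a) x ⟩
      pow q a * pow qi a * x    ≈⟨ *-congʳ (pow-inverse a) ⟩
      1# * x                    ≈⟨ *-identityˡ x ⟩
      x                         ∎

    qpow-⊖ : ∀ a b → qpow (a ⊖ b) ≈ pow q a * pow qi b
    qpow-⊖ zero    zero    = sym (*-identityˡ 1#)
    qpow-⊖ (suc a) zero    = sym (*-identityʳ _)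
    qpow-⊖ zero    (suc b) = sym (*-identityˡ _)
    qpow-⊖ (suc a) (suc b) rewrite ℤP.[1+m]⊖[1+n]≡m⊖n a b = begin
      qpow (a ⊖ b)                      ≈⟨ qpow-⊖ a b ⟩
      pow q a * pow qi b                ≈⟨ *-identityˡ _ ⟨
      1# * (pow q a * pow qi b)         ≈⟨ *-congʳ q*qi≈1 ⟨
      q * qi * (pow q a * pow qi b)
        ≈⟨ solve 4 (λ x y z w → (x :* z) :* (y :* w) := (x :* y) :* (z :* w)) refl q (pow q a) qi (pow qi b) ⟩
      q * pow q a * (qi * pow qi b)     ∎

    qpow-[+a]-[+b] : ∀ a b → qpow (+ a ℤ.- + b) ≈ pow q a * pow qi b
    qpow-[+a]-[+b] a b rewrite ℤP.[+m]-[+n]≡m⊖n a b = qpow-⊖ a b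

module SequenceSums {c l : Level} (R : CommutativeRing c l) (q qi : CommutativeRing.Carrier R)
                    (cont : ℕ → ℤ) (hi : ℕ) where
  open CommutativeRing R
  open QDefs R q qi
  open QCalculus R q qi
  open NaturalCoefficients commutativeSemiring
  open import Relation.Binary.Reasoning.Setoid setoid

  cellFactor : ℕ → ℕ → Carrier
  cellFactor x m = qint ((+ x) ℤ.+ (+ 1) ℤ.- (+ m) ℤ.+ cont x)

  seqSum : ℕ → ℕ → ℕ → Carrier
  seqSum lo m k = sumL (map (term cont m) (incSeqs lo hi k))

  scaledSeqSum : ℕ → ℕ → ℕ → Carrier
  scaledSeqSum lo m k = pow q (hi ℕ.* k) * seqSum lo m k

  seqSum-split : ∀ {lo} m k → lo < hi →
    seqSum lo m (suc k) ≈
    pow qi (suc lo) * cellFactor (suc lo) m * seqSum (suc lo) (suc m) k + seqSum (suc lo) m (suc k)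
  seqSum-split {lo} m k lo<hi = begin
    seqSum lo m (suc k)
      ≡⟨ ≡.cong (sumL ∘ map (term cont m)) (incSeqs-split lo hi k lo<hi) ⟩
    sumL (map (term cont m) (map (suc lo ∷_) (incSeqs (suc lo) hi k) ++ incSeqs (suc lo) hi (suc k)))
      ≈⟨ sumL-map-++ (term cont m) (map (suc lo ∷_) (incSeqs (suc lo) hi k)) (incSeqs (suc lo) hi (suc k)) ⟩
    sumL (map (term cont m) (map (suc lo ∷_) (incSeqs (suc lo) hi k))) + seqSum (suc lo) m (suc k)
      ≡⟨ ≡.cong (λ s → sumL s + seqSum (suc lo) m (suc k)) (≡.sym (ListP.map-∘ (incSeqs (suc lo) hi k))) ⟩
    sumL (map (λ xs → pow qi (suc lo) * cellFactor (suc lo) m * term cont (suc m) xs) (incSeqs (suc lo) hi k))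
      + seqSum (suc lo) m (suc k)
      ≈⟨ +-congʳ (sumL-map-*ˡ _ (term cont (suc m)) (incSeqs (suc lo) hi k)) ⟩
    pow qi (suc lo) * cellFactor (suc lo) m * seqSum (suc lo) (suc m) k + seqSum (suc lo) m (suc k) ∎

  scaledSeqSum[lo,m,0]≈1 : ∀ lo m → scaledSeqSum lo m 0 ≈ 1#
  scaledSeqSum[lo,m,0]≈1 lo m = begin
    pow q (hi ℕ.* 0) * (1# + 0#)  ≡⟨ ≡.cong (λ n → pow q n * (1# + 0#)) (ℕP.*-zeroʳ hi) ⟩
    1# * (1# + 0#)                ≈⟨ solve 0 (con 1 :* (con 1 :+ con 0) := con 1) refl ⟩
    1#                            ∎

  scaledSeqSum-empty : ∀ {lo} m k → hi ≤ lo → scaledSeqSum lo m (suc k) ≈ 0#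
  scaledSeqSum-empty {lo} m k hi≤lo =
    trans (*-congˡ (reflexive (≡.cong (sumL ∘ map (term cont m)) (incSeqs-empty lo hi k hi≤lo)))) (zeroʳ _)

  cellFactor-first : ∀ {lo d c m e} → RowSegment cont lo (suc d) c → lo ℕ.+ suc c ≡ m ℕ.+ e →
    cellFactor (suc lo) m ≈ qnat (suc e)
  cellFactor-first {lo} {_} {c} {m} {e} seg lo+c+1≡m+e = reflexive (≡.cong qint
    (≡.trans (≡.cong (λ x → + (suc lo ℕ.+ 1) ℤ.- + m ℤ.+ x) (seg 0 (s≤s z≤n)))
             (+a-+m++c≡+b (suc lo ℕ.+ 1) m c arith)))
    where
    lo+2+c≡ : ∀ lo c → suc lo ℕ.+ 1 ℕ.+ c ≡ suc (lo ℕ.+ suc c)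
    lo+2+c≡ = solve-∀
    arith : suc lo ℕ.+ 1 ℕ.+ c ≡ m ℕ.+ suc e
    arith = ≡.trans (lo+2+c≡ lo c) (≡.trans (≡.cong suc lo+c+1≡m+e) (≡.sym (ℕP.+-suc m e)))

  module _ (q*qi≈1 : q * qi ≈ 1#) where

    scaledSeqSum-rec : ∀ {lo d c m e} k → suc lo ℕ.+ d ≡ hi →
      RowSegment cont lo (suc d) c → lo ℕ.+ suc c ≡ m ℕ.+ e →
      scaledSeqSum lo m (suc k) ≈
      pow q d * qnat (suc e) * scaledSeqSum (suc lo) (suc m) k + scaledSeqSum (suc lo) m (suc k)
    scaledSeqSum-rec {lo} {d} {c} {m} {e} k lo+1+d≡hi seg first = begin
      pow q (hi ℕ.* suc k) * seqSum lo m (suc k)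
        ≈⟨ *-congˡ (seqSum-split m k lo<hi) ⟩
      pow q (hi ℕ.* suc k) * (qi^[lo+1] * F * S₁ + S₂)
        ≈⟨ distribˡ _ _ _ ⟩
      pow q (hi ℕ.* suc k) * (qi^[lo+1] * F * S₁) + scaledSeqSum (suc lo) m (suc k)
        ≈⟨ +-congʳ (*-congʳ (trans (reflexive (≡.cong (pow q) (ℕP.*-suc hi k))) (pow-+ q hi (hi ℕ.* k)))) ⟩
      pow q hi * pow q (hi ℕ.* k) * (qi^[lo+1] * F * S₁) + scaledSeqSum (suc lo) m (suc k)
        ≈⟨ +-congʳ (solve 5 (λ a b x y z → a :* b :* (x :* y :* z) := a :* x :* y :* (b :* z))
                            refl (pow q hi) (pow q (hi ℕ.* k)) qi^[lo+1] F S₁) ⟩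
      pow q hi * qi^[lo+1] * F * scaledSeqSum (suc lo) (suc m) k + scaledSeqSum (suc lo) m (suc k)
        ≈⟨ +-congʳ (*-congʳ (*-cong q^hi*qi^[lo+1]≈q^d (cellFactor-first {lo} {d} {c} {m} {e} seg first))) ⟩
      pow q d * qnat (suc e) * scaledSeqSum (suc lo) (suc m) k + scaledSeqSum (suc lo) m (suc k) ∎
      where
      qi^[lo+1] = pow qi (suc lo)
      F = cellFactor (suc lo) m
      S₁ = seqSum (suc lo) (suc m) k
      S₂ = seqSum (suc lo) m (suc k)
      lo<hi : lo < hi
      lo<hi = ≡.subst (suc lo ≤_) lo+1+d≡hi (ℕP.m≤m+n (suc lo) d)
      q^hi*qi^[lo+1]≈q^d : pow q hi * qi^[lo+1] ≈ pow q d
      q^hi*qi^[lo+1]≈q^d =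
        ≡.subst (λ n → pow q n * qi^[lo+1] ≈ pow q d) lo+1+d≡hi (pow-+-cancelˡ q*qi≈1 (suc lo) d)

    scaledSeqSum≈scaledProductFormula : ∀ d e k {lo m c} → lo ℕ.+ d ≡ hi →
      RowSegment cont lo d c → lo ℕ.+ suc c ≡ m ℕ.+ e →
      scaledSeqSum lo m k ≈ scaledProductFormula d e k
    scaledSeqSum≈scaledProductFormula d e zero {lo} {m} _ _ _ =
      trans (scaledSeqSum[lo,m,0]≈1 lo m) (sym (scaledProductFormula[d,e,0]≈1 d e))
    scaledSeqSum≈scaledProductFormula zero e (suc k) {lo} {m} lo+0≡hi _ _ =
      trans (scaledSeqSum-empty m k (ℕP.≤-reflexive (≡.trans (≡.sym lo+0≡hi) (ℕP.+-identityʳ lo))))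
            (sym (scaledProductFormula[0,e,1+k]≈0 e k))
    scaledSeqSum≈scaledProductFormula (suc d) e (suc k) {lo} {m} {c} lo+d+1≡hi seg first = begin
      scaledSeqSum lo m (suc k)
        ≈⟨ scaledSeqSum-rec k lo+1+d≡hi seg first ⟩
      pow q d * qnat (suc e) * scaledSeqSum (suc lo) (suc m) k + scaledSeqSum (suc lo) m (suc k)
        ≈⟨ +-cong (*-congˡ (scaledSeqSum≈scaledProductFormula d (suc e) k lo+1+d≡hi seg′ first₁))
                  (scaledSeqSum≈scaledProductFormula d (suc (suc e)) (suc k) lo+1+d≡hi seg′ first₂) ⟩
      pow q d * qnat (suc e) * scaledProductFormula d (suc e) k + scaledProductFormula d (suc (suc e)) (suc k)
        ≈⟨ scaledProductFormula-rec d e k ⟨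
      scaledProductFormula (suc d) e (suc k) ∎
      where
      lo+1+d≡hi : suc lo ℕ.+ d ≡ hi
      lo+1+d≡hi = ≡.trans (≡.sym (ℕP.+-suc lo d)) lo+d+1≡hi
      seg′ : RowSegment cont (suc lo) d (suc c)
      seg′ = RowSegment-tail {cont} {lo} {d} {c} seg
      lo+c+3≡m+e+2 : suc lo ℕ.+ suc (suc c) ≡ suc (suc (m ℕ.+ e))
      lo+c+3≡m+e+2 = ≡.cong suc (≡.trans (ℕP.+-suc lo (suc c)) (≡.cong suc first))
      first₁ : suc lo ℕ.+ suc (suc c) ≡ suc m ℕ.+ suc e
      first₁ = ≡.trans lo+c+3≡m+e+2 (≡.cong suc (≡.sym (ℕP.+-suc m e)))
      first₂ : suc lo ℕ.+ suc (suc c) ≡ m ℕ.+ suc (suc e)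
      first₂ = ≡.trans lo+c+3≡m+e+2 (≡.sym (≡.trans (ℕP.+-suc m (suc e)) (≡.cong suc (ℕP.+-suc m e))))

module HookShapes {c l : Level} (R : CommutativeRing c l) (q qi : CommutativeRing.Carrier R)
                  (q*qi≈1 : CommutativeRing._≈_ R (CommutativeRing._*_ R q qi) (CommutativeRing.1# R)) where
  open CommutativeRing R
  open QDefs R q qi
  open QCalculus R q qi
  open import Relation.Binary.Reasoning.Setoid setoid

  𝓔-hook : ∀ k j D ℓ →
    𝓔 (hook (j ℕ.+ D) ℓ) (hook j ℓ) k ≈ qfact k * qbinom D k * qbinom (j ℕ.+ D ℕ.+ ℓ ℕ.+ j) k
  𝓔-hook k j D ℓ = begin
    qpow (+ (hi ℕ.* k) ℤ.- + C) * seqSum lo 1 k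
      ≈⟨ *-congʳ (qpow-[+a]-[+b] q*qi≈1 (hi ℕ.* k) C) ⟩
    pow q (hi ℕ.* k) * pow qi C * seqSum lo 1 k
      ≈⟨ trans (*-congʳ (*-comm _ _)) (*-assoc _ _ _) ⟩
    pow qi C * scaledSeqSum lo 1 k
      ≈⟨ *-congˡ (scaledSeqSum≈scaledProductFormula q*qi≈1 D (j ℕ.+ s ℕ.+ j) k lo+D≡hi
                    (hook-RowSegment j D ℓ) (ℕP.+-suc (j ℕ.+ s) j)) ⟩
    pow qi C * (pow q C * productFormula D (j ℕ.+ s ℕ.+ j) k)
      ≈⟨ pow-inverse-cancelˡ q*qi≈1 C _ ⟩
    productFormula D (j ℕ.+ s ℕ.+ j) k
      ≡⟨ ≡.cong (λ n → qfact k * qbinom D k * qbinom n k) D+[j+s+j]≡j+D+ℓ+j ⟩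
    qfact k * qbinom D k * qbinom (j ℕ.+ D ℕ.+ ℓ ℕ.+ j) k ∎
    where
    s = sum (replicate ℓ 1)
    lo = sum (hook j ℓ)
    hi = sum (hook (j ℕ.+ D) ℓ)
    C = binom2 k
    open SequenceSums R q qi (labelContent (hook (j ℕ.+ D) ℓ) (hook j ℓ)) hi
    lo+D≡hi : lo ℕ.+ D ≡ hi
    lo+D≡hi = rearrange j s D
      where
      rearrange : ∀ j s D → j ℕ.+ s ℕ.+ D ≡ j ℕ.+ D ℕ.+ s
      rearrange = solve-∀
    D+[j+s+j]≡j+D+ℓ+j : D ℕ.+ (j ℕ.+ s ℕ.+ j) ≡ j ℕ.+ D ℕ.+ ℓ ℕ.+ j
    D+[j+s+j]≡j+D+ℓ+j rewrite sum-replicate-1 ℓ = rearrange D j ℓ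
      where
      rearrange : ∀ D j ℓ → D ℕ.+ (j ℕ.+ ℓ ℕ.+ j) ≡ j ℕ.+ D ℕ.+ ℓ ℕ.+ j
      rearrange = solve-∀

open import Data.Nat using (_+_)

proposition5p24 : {c l : Level} (R : CommutativeRing c l)
    (q qi : CommutativeRing.Carrier R) →
    CommutativeRing._≈_ R (CommutativeRing._*_ R q qi) (CommutativeRing.1# R) →
    (k n ℓ : ℕ) → 1 ≤ n → ℓ < n →
    (j : ℕ) → 1 ≤ j → j ≤ n ∸ ℓ →
    CommutativeRing._≈_ R
      (QDefs.𝓔 R q qi (hook (n ∸ ℓ) ℓ) (hook j ℓ) k)
      (CommutativeRing._*_ R
        (CommutativeRing._*_ R (QDefs.qfact R q qi k) (QDefs.qbinom R q qi (n ∸ j ∸ ℓ) k))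
        (QDefs.qbinom R q qi (n + j) k))
proposition5p24 R q qi q*qi≈1 k n ℓ _ ℓ<n j _ j≤n∸ℓ = begin
  𝓔 (hook (n ∸ ℓ) ℓ) (hook j ℓ) k
    ≡⟨ ≡.cong (λ m → 𝓔 (hook m ℓ) (hook j ℓ) k) (≡.sym j+D≡n∸ℓ) ⟩
  𝓔 (hook (j + D) ℓ) (hook j ℓ) k
    ≈⟨ 𝓔-hook k j D ℓ ⟩
  qfact k * qbinom D k * qbinom (j + D + ℓ + j) k
    ≡⟨ ≡.cong₂ (λ a b → qfact k * qbinom a k * qbinom b k)
               (∸-∸-comm n ℓ j) (≡.cong (_+ j) (≡.sym n≡j+D+ℓ)) ⟩
  qfact k * qbinom (n ∸ j ∸ ℓ) k * qbinom (n + j) k ∎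
  where
  open CommutativeRing R using (_*_; setoid)
  open QDefs R q qi using (𝓔; qfact; qbinom)
  open HookShapes R q qi q*qi≈1 using (𝓔-hook)
  open import Relation.Binary.Reasoning.Setoid setoid
  D = n ∸ ℓ ∸ j
  j+D≡n∸ℓ : j + D ≡ n ∸ ℓ
  j+D≡n∸ℓ = ℕP.m+[n∸m]≡n j≤n∸ℓ
  n≡j+D+ℓ : n ≡ j + D + ℓ
  n≡j+D+ℓ = ≡.trans (≡.sym (ℕP.m∸n+n≡m (ℕP.<⇒≤ ℓ<n))) (≡.cong (_+ ℓ) (≡.sym j+D≡n∸ℓ))
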